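{- Let $Q$ be a continuous quantale and $(X,d)$ a $Q$-metric space. Then: (1) $A\subseteq B_R(A,\delta)\subseteq B_R(A',\delta')$ whenever $A\subseteq A'\subseteq X$ and $\delta'\sqsubseteq\delta\ll I$; (2) $B_R(B_R(A,\delta_1),\delta_2)\subseteq B_R(A,\delta)$ whenever $A\subseteq X$, $\delta_1,\delta_2\ll I$ and $\delta\ll\delta_1\otimes\delta_2$; (3) $\overline{A}^o=\bigcap_{\delta\ll I}B_R(A,\delta)$ for every $A\subseteq X$; (4) $B_R(\overline{A}^o,\delta)=B_R(A,\delta)$ for every $A\subseteq X$ and $\delta\ll I$; (5) $B_R(A,\delta)\subseteq A_\delta\subseteq B_R(A,\delta')$ whenever $A\subseteq X$ and $\delta'\ll\delta\ll I$.
   Context: A quantale is a complete lattice $(Q,\sqsubseteq)$ with a monoid structure $(\otimes,I)$ such that $\otimes$ distributes over arbitrary joins on both sides. $x\ll y$ (way-below) means: for every directed $D\subseteq Q$ with $y\sqsubseteq\bigsqcup D$ there is $d\in D$ with $x\sqsubseteq d$. $Q$ is continuous if $x=\bigsqcup\{z\mid z\ll x\}$ for all $x$. A $Q$-metric space is a pair $(X,d)$ with $d:X\times X\to Q$ satisfying $d(x,y)\otimes d(y,z)\sqsubseteq d(x,z)$ and $I\sqsubseteq d(x,x)$ (not necessarily symmetric). The dual open ball topology $\tau_d^o$ on $X$ is generated by the sets $B^o(x,\delta)=\{y\in X\mid\delta\ll d(y,x)\}$ for $x\in X$, $\delta\ll I$; $\overline{A}^o$ denotes the closure of $A\subseteq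 X$ in $\tau_d^o$. For $A\subseteq X$ and $\delta\ll I$: $B_R(A,\delta)=\{y\in X\mid \exists x\in A.\ \delta\ll d(x,y)\}$, and the $\delta$-flattening of $A$ is $A_\delta=\overline{B_R(A,\delta)}^o$. -}

module Defs where

open import Level using (Level; _⊔_; Setω) renaming (zero to 0ℓ; suc to lsuc)
open import Data.Product using (Σ; ∃; _×_; _,_)
open import Data.Unit.Polymorphic using (⊤)
open import Relation.Nullary using (¬_)
open import Relation.Binary.PropositionalEquality using (_≡_)
open import Relation.Unary using (Pred; _⊆_)
open import Function.Bundles using (_⇔_)

record Quantale : Setω where
  infix  4 _⊑_
  infixl 7 _⊗_
  field
    Carrier   : Set
    _⊑_       : Carrier → Carrier → Set
    ⊑-refl    : ∀ {x} → x ⊑ x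
    ⊑-trans   : ∀ {x y z} → x ⊑ y → y ⊑ z → x ⊑ z
    ⊑-antisym : ∀ {x y} → x ⊑ y → y ⊑ x → x ≡ y
    ⋁         : ∀ {ℓ} → Pred Carrier ℓ → Carrier
    ⋁-upper   : ∀ {ℓ} (S : Pred Carrier ℓ) {x} → S x → x ⊑ ⋁ S
    ⋁-least   : ∀ {ℓ} (S : Pred Carrier ℓ) {u} → (∀ {x} → S x → x ⊑ u) → ⋁ S ⊑ u
    _⊗_       : Carrier → Carrier → Carrier
    I         : Carrier
    ⊗-assoc   : ∀ x y z → (x ⊗ y) ⊗ z ≡ x ⊗ (y ⊗ z)
    ⊗-identityˡ : ∀ x → I ⊗ x ≡ x
    ⊗-identityʳ : ∀ x → x ⊗ I ≡ x
    ⊗-distribˡ-⋁ : ∀ {ℓ} (a : Carrier) (S : Pred Carrier ℓ) →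
                   a ⊗ ⋁ S ≡ ⋁ (λ y → Σ Carrier λ s → S s × (y ≡ a ⊗ s))
    ⊗-distribʳ-⋁ : ∀ {ℓ} (a : Carrier) (S : Pred Carrier ℓ) →
                   ⋁ S ⊗ a ≡ ⋁ (λ y → Σ Carrier λ s → S s × (y ≡ s ⊗ a))

module QuantaleNotions (Q : Quantale) where
  open Quantale Q

  Directed : Pred Carrier 0ℓ → Set
  Directed D = (∃ λ d → D d) ×
               (∀ {a b} → D a → D b → ∃ λ c → D c × a ⊑ c × b ⊑ c)

  infix 4 _≪_
  _≪_ : Carrier → Carrier → Set₁
  x ≪ y = (D : Pred Carrier 0ℓ) → Directed D → y ⊑ ⋁ D →
          ∃ λ d → D d × x ⊑ d

  Continuous : Set
  Continuous = ∀ x → x ≡ ⋁ (λ z → z ≪ x)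

open QuantaleNotions public

record QMetricSpace (Q : Quantale) : Set₁ where
  open Quantale Q
  field
    X      : Set
    d      : X → X → Carrier
    d-tri  : ∀ x y z → d x y ⊗ d y z ⊑ d x z
    d-refl : ∀ x → I ⊑ d x x

module MetricNotions {Q : Quantale} (M : QMetricSpace Q) where
  open Quantale Q
  open QMetricSpace M

  Bᵒ : X → Carrier → Pred X (lsuc 0ℓ)
  Bᵒ x δ y = _≪_ Q δ (d y x)

  -- open sets of the topology τᵒ_d generated by the dual open balls
  -- (the least family containing the balls B^o(x,δ) with δ ≪ I, closed
  --  under finite intersections and arbitrary unions, up to extensional
  --  equality of subsets)
  data Openᵒ : Pred X (lsuc 0ℓ) → Set₂ where
    ball  : ∀ x δ → _≪_ Q δ I → Openᵒ (Bᵒ x δ)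
    whole : Openᵒ (λ _ → ⊤)
    inter : ∀ {U V} → Openᵒ U → Openᵒ V → Openᵒ (λ y → U y × V y)
    union : {J : Set₁} (F : J → Pred X (lsuc 0ℓ)) → (∀ j → Openᵒ (F j)) →
            Openᵒ (λ y → Σ J λ j → F j y)
    ext   : ∀ {U V} → Openᵒ U → (∀ y → U y ⇔ V y) → Openᵒ V

  Closedᵒ : Pred X (lsuc 0ℓ) → Set₂
  Closedᵒ C = Σ (Pred X (lsuc 0ℓ)) λ U → Openᵒ U × (∀ y → C y ⇔ (¬ U y))

  closureᵒ : ∀ {a} → Pred X a → Pred X (a ⊔ lsuc (lsuc 0ℓ))
  closureᵒ A y = (C : Pred X (lsuc 0ℓ)) → Closedᵒ C → A ⊆ C → C y

  BR : ∀ {a} → Pred X a → Carrier → Pred X (a ⊔ lsuc 0ℓ)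
  BR A δ y = Σ X λ x → A x × _≪_ Q δ (d x y)

  flat : ∀ {a} → Pred X a → Carrier → Pred X (a ⊔ lsuc (lsuc 0ℓ))
  flat A δ = closureᵒ (BR A δ)

  ⋂BR : ∀ {a} → Pred X a → Pred X (a ⊔ lsuc 0ℓ)
  ⋂BR A y = ∀ δ → _≪_ Q δ I → BR A δ y

open MetricNotions public

module Prop6Claims {Q : Quantale} (M : QMetricSpace Q) where
  open Quantale Q
  open QMetricSpace M

  Claim1 : Set₁
  Claim1 = ∀ (A A' : Pred X 0ℓ) (δ δ' : Carrier) → A ⊆ A' → δ' ⊑ δ → _≪_ Q δ I →
             (A ⊆ BR M A δ) × (BR M A δ ⊆ BR M A' δ')

  Claim2 : Set₁
  Claim2 = ∀ (A : Pred X 0ℓ) (δ₁ δ₂ δ : Carrier) → _≪_ Q δ₁ I → _≪_ Q δ₂ I →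
             _≪_ Q δ (δ₁ ⊗ δ₂) → BR M (BR M A δ₁) δ₂ ⊆ BR M A δ

  Claim3 : Set₂
  Claim3 = ∀ (A : Pred X 0ℓ) →
             (closureᵒ M A ⊆ ⋂BR M A) × (⋂BR M A ⊆ closureᵒ M A)

  Claim4 : Set₂
  Claim4 = ∀ (A : Pred X 0ℓ) (δ : Carrier) → _≪_ Q δ I →
             (BR M (closureᵒ M A) δ ⊆ BR M A δ) × (BR M A δ ⊆ BR M (closureᵒ M A) δ)

  Claim5 : Set₂
  Claim5 = ∀ (A : Pred X 0ℓ) (δ δ' : Carrier) → _≪_ Q δ' δ → _≪_ Q δ I →
             (BR M A δ ⊆ flat M A δ) × (flat M A δ ⊆ BR M A δ')

open Prop6Claims public

-- Every element a of a continuous quantale is approximated from below by the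
-- products ε ⊗ a and a ⊗ ε with ε ≪ I, because I = ⋁ {ε | ε ≪ I} and ⊗ preserves
-- joins.  Together with interpolation for ≪ this yields, for every δ ≪ d(y,x), an
-- ε ≪ I with B^o(y,ε) ⊆ B^o(x,δ): dual open balls, hence all τ_d^o-open sets, are
-- neighbourhoods of each of their points.  So y lies in the closure of A iff every
-- ball B^o(y,δ) meets A, i.e. iff y ∈ B_R(A,δ) for all δ ≪ I, which is (3).  Claims
-- (1) and (2) are immediate from the metric axioms, and (4) and (5) follow from (3)
-- with the same approximation trick.
module Submission where

open import Defs
  using (Quantale; module QuantaleNotions; Continuous; QMetricSpace; module MetricNotions;
         Claim1; Claim2; Claim3; Claim4; Claim5)
open import Level using (Level)
open import Data.Empty using (⊥)
open import Data.Product using (_×_; Σ; ∃; _,_)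
open import Data.Sum using (_⊎_; inj₁; inj₂)
open import Relation.Nullary using (¬_)
open import Relation.Nullary.Decidable using (True; toWitness; fromWitness; decidable-stable)
open import Relation.Binary.PropositionalEquality using (_≡_; refl; sym; cong; subst; module ≡-Reasoning)
open import Relation.Unary using (Pred; _⊆_)
open import Function.Bundles using (Equivalence)
open import Function.Construct.Identity using (⇔-id)
open import Axiom.ExcludedMiddle using (ExcludedMiddle)

module QuantaleOrder (Q : Quantale) where
  open Quantale Q
  open QuantaleNotions Q using (_≪_)

  ≡⇒⊑ : ∀ {a b} → a ≡ b → a ⊑ b
  ≡⇒⊑ refl = ⊑-refl

  ⋁-downset : ∀ b → ⋁ (_⊑ b) ≡ b
  ⋁-downset b = ⊑-antisym (⋁-least (_⊑ b) (λ p → p)) (⋁-upper (_⊑ b) ⊑-refl)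

  Image : ∀ {ℓ} → (Carrier → Carrier) → Pred Carrier ℓ → Pred Carrier ℓ
  Image f S y = Σ Carrier λ s → S s × (y ≡ f s)

  Monotone : (Carrier → Carrier) → Set
  Monotone f = ∀ {a b} → a ⊑ b → f a ⊑ f b

  ⊗-monoˡ : ∀ c → Monotone (_⊗ c)
  ⊗-monoˡ c {a} {b} a⊑b =
    subst (λ w → a ⊗ c ⊑ w ⊗ c) (⋁-downset b)
      (subst (a ⊗ c ⊑_) (sym (⊗-distribʳ-⋁ c (_⊑ b)))
        (⋁-upper (Image (_⊗ c) (_⊑ b)) (a , a⊑b , refl)))

  ⊗-monoʳ : ∀ c → Monotone (c ⊗_)
  ⊗-monoʳ c {a} {b} a⊑b =
    subst (λ w → c ⊗ a ⊑ c ⊗ w) (⋁-downset b)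
      (subst (c ⊗ a ⊑_) (sym (⊗-distribˡ-⋁ c (_⊑ b)))
        (⋁-upper (Image (c ⊗_) (_⊑ b)) (a , a⊑b , refl)))

  ⊗-mono : ∀ {a b c e} → a ⊑ b → c ⊑ e → a ⊗ c ⊑ b ⊗ e
  ⊗-mono {b = b} a⊑b c⊑e = ⊑-trans (⊗-monoˡ _ a⊑b) (⊗-monoʳ b c⊑e)

  ≪⇒⊑ : ∀ {a b} → a ≪ b → a ⊑ b
  ≪⇒⊑ {a} {b} a≪b with a≪b (_⊑ b) ((b , ⊑-refl) , λ a⊑b c⊑b → b , ⊑-refl , a⊑b , c⊑b)
                           (⋁-upper (_⊑ b) ⊑-refl)
  ... | e , e⊑b , a⊑e = ⊑-trans a⊑e e⊑b

  ⊑-≪-trans : ∀ {a b c} → a ⊑ b → b ≪ c → a ≪ c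
  ⊑-≪-trans a⊑b b≪c D dir c⊑⋁D with b≪c D dir c⊑⋁D
  ... | e , De , b⊑e = e , De , ⊑-trans a⊑b b⊑e

  ≪-⊑-trans : ∀ {a b c} → a ≪ b → b ⊑ c → a ≪ c
  ≪-⊑-trans a≪b b⊑c D dir c⊑⋁D = a≪b D dir (⊑-trans b⊑c c⊑⋁D)

  ⊥ᴼ : Carrier
  ⊥ᴼ = ⋁ (λ _ → ⊥)

  ⊥ᴼ-≪ : ∀ {a} → ⊥ᴼ ≪ a
  ⊥ᴼ-≪ D ((e , De) , _) _ = e , De , ⋁-least (λ _ → ⊥) (λ ())

  infixr 6 _∨_
  _∨_ : Carrier → Carrier → Carrier
  a ∨ b = ⋁ (λ z → (z ≡ a) ⊎ (z ≡ b))

  x⊑x∨y : ∀ {a b} → a ⊑ a ∨ b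
  x⊑x∨y = ⋁-upper _ (inj₁ refl)

  y⊑x∨y : ∀ {a b} → b ⊑ a ∨ b
  y⊑x∨y = ⋁-upper _ (inj₂ refl)

  ∨-least : ∀ {a b c} → a ⊑ c → b ⊑ c → a ∨ b ⊑ c
  ∨-least a⊑c b⊑c = ⋁-least _ λ { (inj₁ refl) → a⊑c ; (inj₂ refl) → b⊑c }

  ∨-≪ : ∀ {a b c} → a ≪ c → b ≪ c → a ∨ b ≪ c
  ∨-≪ a≪c b≪c D dir@(_ , up) c⊑⋁D with a≪c D dir c⊑⋁D | b≪c D dir c⊑⋁D
  ... | e₁ , De₁ , a⊑e₁ | e₂ , De₂ , b⊑e₂ with up De₁ De₂
  ... | e , De , e₁⊑e , e₂⊑e = e , De , ∨-least (⊑-trans a⊑e₁ e₁⊑e) (⊑-trans b⊑e₂ e₂⊑e)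

  -- Directedness for subsets of any size; at level 0 it is  Directed Q.
  IsDirected : ∀ {ℓ} → Pred Carrier ℓ → Set ℓ
  IsDirected D = (∃ λ d → D d) × (∀ {a b} → D a → D b → ∃ λ c → D c × a ⊑ c × b ⊑ c)

  ≪-directed : ∀ y → IsDirected (_≪ y)
  ≪-directed y = (⊥ᴼ , ⊥ᴼ-≪) , λ a≪y b≪y → _ , ∨-≪ a≪y b≪y , x⊑x∨y , y⊑x∨y

  Image-directed : ∀ {ℓ} {S : Pred Carrier ℓ} f → Monotone f → IsDirected S →
                   IsDirected (Image f S)
  Image-directed f f-mono ((s , Ss) , up) =
    (f s , s , Ss , refl) ,
    λ { (a , Sa , refl) (b , Sb , refl) →
          let c , Sc , a⊑c , b⊑c = up Sa Sb in
          f c , (c , Sc , refl) , f-mono a⊑c , f-mono b⊑c }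

module WayBelow (lem : ∀ {ℓ : Level} → ExcludedMiddle ℓ) (Q : Quantale) (cont : Continuous Q) where
  open Quantale Q
  open QuantaleNotions Q using (_≪_)
  open QuantaleOrder Q

  -- The definition of ≪ only tests small directed sets; excluded middle replaces a
  -- large directed set by the small one  λ z → True (lem {P = D z}).
  ≪-⋁-directed : ∀ {ℓ x y} {D : Pred Carrier ℓ} → x ≪ y → IsDirected D → y ⊑ ⋁ D →
                 ∃ λ d → D d × x ⊑ d
  ≪-⋁-directed {D = D} x≪y ((d , Dd) , up) y⊑⋁D
    with x≪y small small-directed (⊑-trans y⊑⋁D (⋁-least D (λ Dz → ⋁-upper small (fromWitness Dz))))
    where
    small : Pred Carrier _
    small z = True (lem {P = D z})
    small-directed : IsDirected small
    small-directed =
      (d , fromWitness Dd) ,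
      λ Sa Sb → let c , Dc , a⊑c , b⊑c = up (toWitness Sa) (toWitness Sb) in
                c , fromWitness Dc , a⊑c , b⊑c
  ... | e , Se , x⊑e = e , toWitness Se , x⊑e

  ⊑-from-≪ : ∀ {x u} → (∀ {z} → z ≪ x → z ⊑ u) → x ⊑ u
  ⊑-from-≪ {x} below = ⊑-trans (≡⇒⊑ (cont x)) (⋁-least (_≪ x) below)

  ≪-interpolate : ∀ {x y} → x ≪ y → ∃ λ v → x ≪ v × v ≪ y
  ≪-interpolate {y = y} x≪y with ≪-⋁-directed x≪y interpolants-directed y⊑⋁interpolants
    where
    interpolants : Pred Carrier _
    interpolants u = ∃ λ v → u ≪ v × v ≪ y
    interpolants-directed : IsDirected interpolants
    interpolants-directed =
      (⊥ᴼ , ⊥ᴼ , ⊥ᴼ-≪ , ⊥ᴼ-≪) ,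
      λ (v₁ , a≪v₁ , v₁≪y) (v₂ , b≪v₂ , v₂≪y) →
        _ , (v₁ ∨ v₂ , ∨-≪ (≪-⊑-trans a≪v₁ x⊑x∨y) (≪-⊑-trans b≪v₂ y⊑x∨y) , ∨-≪ v₁≪y v₂≪y) ,
        x⊑x∨y , y⊑x∨y
    y⊑⋁interpolants : y ⊑ ⋁ interpolants
    y⊑⋁interpolants =
      ⊑-from-≪ λ v≪y → ⊑-from-≪ λ u≪v → ⋁-upper interpolants (_ , u≪v , v≪y)
  ... | u , (v , u≪v , v≪y) , x⊑u = v , ⊑-≪-trans x⊑u u≪v , v≪y

  ≪-approx : ∀ {x y} f → Monotone f → y ≡ ⋁ (Image f (_≪ I)) → x ≪ y →
             ∃ λ ε → ε ≪ I × x ≪ f ε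
  ≪-approx f f-mono y≡⋁ x≪y with ≪-interpolate x≪y
  ... | v , x≪v , v≪y
    with ≪-⋁-directed v≪y (Image-directed f f-mono (≪-directed I)) (≡⇒⊑ y≡⋁)
  ... | _ , (ε , ε≪I , refl) , v⊑fε = ε , ε≪I , ≪-⊑-trans x≪v v⊑fε

  open ≡-Reasoning

  ≪-approxˡ : ∀ {x a} → x ≪ a → ∃ λ ε → ε ≪ I × x ≪ ε ⊗ a
  ≪-approxˡ {a = a} = ≪-approx (_⊗ a) (⊗-monoˡ a) (begin
    a                          ≡⟨ sym (⊗-identityˡ a) ⟩
    I ⊗ a                      ≡⟨ cong (_⊗ a) (cont I) ⟩
    ⋁ (_≪ I) ⊗ a               ≡⟨ ⊗-distribʳ-⋁ a (_≪ I) ⟩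
    ⋁ (Image (_⊗ a) (_≪ I))    ∎)

  ≪-approxʳ : ∀ {x a} → x ≪ a → ∃ λ ε → ε ≪ I × x ≪ a ⊗ ε
  ≪-approxʳ {a = a} = ≪-approx (a ⊗_) (⊗-monoʳ a) (begin
    a                          ≡⟨ sym (⊗-identityʳ a) ⟩
    a ⊗ I                      ≡⟨ cong (a ⊗_) (cont I) ⟩
    a ⊗ ⋁ (_≪ I)               ≡⟨ ⊗-distribˡ-⋁ a (_≪ I) ⟩
    ⋁ (Image (a ⊗_) (_≪ I))    ∎)

module Balls (lem : ∀ {ℓ : Level} → ExcludedMiddle ℓ) (Q : Quantale) (cont : Continuous Q)
             (M : QMetricSpace Q) where
  open Quantale Q
  open QuantaleNotions Q using (_≪_)
  open QuantaleOrder Q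
  open WayBelow lem Q cont
  open QMetricSpace M
  open MetricNotions M
  open Equivalence

  ⊆-BR : ∀ {a} {A : Pred X a} {δ} → δ ≪ I → A ⊆ BR A δ
  ⊆-BR δ≪I {x} Ax = x , Ax , ≪-⊑-trans δ≪I (d-refl x)

  BR-mono : ∀ {a b} {A : Pred X a} {A' : Pred X b} {δ δ'} → A ⊆ A' → δ' ⊑ δ →
            BR A δ ⊆ BR A' δ'
  BR-mono A⊆A' δ'⊑δ (x , Ax , δ≪dxy) = x , A⊆A' Ax , ⊑-≪-trans δ'⊑δ δ≪dxy

  BR-BR⊆BR : ∀ {a} {A : Pred X a} {δ₁ δ₂ δ} → δ ≪ δ₁ ⊗ δ₂ → BR (BR A δ₁) δ₂ ⊆ BR A δ
  BR-BR⊆BR δ≪δ₁⊗δ₂ (x' , (x , Ax , δ₁≪dxx') , δ₂≪dx'y) =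
    x , Ax , ≪-⊑-trans δ≪δ₁⊗δ₂
               (⊑-trans (⊗-mono (≪⇒⊑ δ₁≪dxx') (≪⇒⊑ δ₂≪dx'y)) (d-tri x x' _))

  Bᵒ-nbhd : ∀ {x y δ} → Bᵒ x δ y → ∃ λ ε → ε ≪ I × Bᵒ y ε ⊆ Bᵒ x δ
  Bᵒ-nbhd {x} {y} δ≪dyx with ≪-approxˡ δ≪dyx
  ... | ε , ε≪I , δ≪ε⊗dyx =
    ε , ε≪I , λ {z} ε≪dzy →
      ≪-⊑-trans δ≪ε⊗dyx (⊑-trans (⊗-monoˡ (d y x) (≪⇒⊑ ε≪dzy)) (d-tri z y x))

  Openᵒ-nbhd : ∀ {U y} → Openᵒ U → U y → ∃ λ ε → ε ≪ I × Bᵒ y ε ⊆ U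
  Openᵒ-nbhd (ball x δ _) y∈B = Bᵒ-nbhd y∈B
  Openᵒ-nbhd whole _ = ⊥ᴼ , ⊥ᴼ-≪ , _
  Openᵒ-nbhd (inter U-open V-open) (Uy , Vy)
    with Openᵒ-nbhd U-open Uy | Openᵒ-nbhd V-open Vy
  ... | ε₁ , ε₁≪I , B⊆U | ε₂ , ε₂≪I , B⊆V =
    ε₁ ∨ ε₂ , ∨-≪ ε₁≪I ε₂≪I ,
    λ ε≪dzy → B⊆U (⊑-≪-trans x⊑x∨y ε≪dzy) , B⊆V (⊑-≪-trans y⊑x∨y ε≪dzy)
  Openᵒ-nbhd (union F F-open) (j , Fjy) with Openᵒ-nbhd (F-open j) Fjy
  ... | ε , ε≪I , B⊆Fj = ε , ε≪I , λ z∈B → j , B⊆Fj z∈B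
  Openᵒ-nbhd (ext U-open U⇔V) Vy with Openᵒ-nbhd U-open (from (U⇔V _) Vy)
  ... | ε , ε≪I , B⊆U = ε , ε≪I , λ z∈B → to (U⇔V _) (B⊆U z∈B)

  ⊆-closureᵒ : ∀ {a} {A : Pred X a} → A ⊆ closureᵒ A
  ⊆-closureᵒ Ax _ _ A⊆C = A⊆C Ax

  -- The complement of B^o(y,δ) is a closed superset of A missing y unless it meets A.
  closureᵒ⊆⋂BR : ∀ {a} {A : Pred X a} → closureᵒ A ⊆ ⋂BR A
  closureᵒ⊆⋂BR {x = y} y∈cl δ δ≪I =
    decidable-stable lem λ y∉BR →
      y∈cl (λ z → ¬ Bᵒ y δ z) (Bᵒ y δ , ball y δ δ≪I , λ z → ⇔-id _)
           (λ Ax δ≪dxy → y∉BR (_ , Ax , δ≪dxy))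
           (≪-⊑-trans δ≪I (d-refl y))

  ⋂BR⊆closureᵒ : ∀ {a} {A : Pred X a} → ⋂BR A ⊆ closureᵒ A
  ⋂BR⊆closureᵒ y∈⋂BR C (U , U-open , C⇔¬U) A⊆C = from (C⇔¬U _) λ Uy →
    let ε , ε≪I , B⊆U = Openᵒ-nbhd U-open Uy
        x , Ax , ε≪dxy = y∈⋂BR ε ε≪I
    in to (C⇔¬U x) (A⊆C Ax) (B⊆U ε≪dxy)

  BR-closureᵒ⊆BR : ∀ {a} {A : Pred X a} {δ} → BR (closureᵒ A) δ ⊆ BR A δ
  BR-closureᵒ⊆BR (x , x∈cl , δ≪dxy) with Bᵒ-nbhd δ≪dxy
  ... | ε , ε≪I , B⊆B with closureᵒ⊆⋂BR x∈cl ε ε≪I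
  ... | x' , Ax' , ε≪dx'x = x' , Ax' , B⊆B ε≪dx'x

  flat⊆BR : ∀ {a} {A : Pred X a} {δ δ'} → δ' ≪ δ → flat A δ ⊆ BR A δ'
  flat⊆BR δ'≪δ y∈flat with ≪-approxʳ δ'≪δ
  ... | ε , ε≪I , δ'≪δ⊗ε = BR-BR⊆BR δ'≪δ⊗ε (closureᵒ⊆⋂BR y∈flat ε ε≪I)

proposition6 : (lem : ∀ {ℓ : Level} → ExcludedMiddle ℓ) →
    (Q : Quantale) → Continuous Q → (M : QMetricSpace Q) →
    Claim1 M × Claim2 M × Claim3 M × Claim4 M × Claim5 M
proposition6 lem Q cont M =
  (λ _ _ _ _ A⊆A' δ'⊑δ δ≪I → ⊆-BR δ≪I , BR-mono A⊆A' δ'⊑δ) ,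
  (λ _ _ _ _ _ _ δ≪δ₁⊗δ₂ → BR-BR⊆BR δ≪δ₁⊗δ₂) ,
  (λ _ → closureᵒ⊆⋂BR , ⋂BR⊆closureᵒ) ,
  (λ _ _ _ → BR-closureᵒ⊆BR , BR-mono ⊆-closureᵒ (Quantale.⊑-refl Q)) ,
  (λ _ _ _ δ'≪δ _ → ⊆-closureᵒ , flat⊆BR δ'≪δ)
  where open Balls lem Q cont M
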